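{- Let $\epsilon=2\times 10^{ -8}$, $\delta=2\times 10^{ -6}$, $s=2\times 10^{ -4}$, let $d\ge 1/\epsilon$ be an integer, let $G=(V,E)$ be a graph and $K=(V,E_K)$ an $(\epsilon,d)$-kernel of $G$ with $\mu(G)\ge (2-\delta)\mu(K)$. Fix $i\in\{1,\dots,1/\epsilon\}$, let $V_H=\{v: d_K(v)\ge d(1-2s-i\epsilon^2)\}$, let $M$ be a maximum matching of $K$ leaving at most $7s\cdot\mu(K)$ nodes of $V_H$ unmatched, and let $M^*$ be a maximum matching of $G$. Then at least $(1-88s)\cdot\mu(K)$ edges of $M$ are 3-augmentable (with respect to $M^*$).
   Context: $\mu(\cdot)$ is maximum matching size, $d_K(v)$ the degree in $K$. An $(\epsilon,d)$-kernel of $G=(V,E)$ is a subgraph $K=(V,E_K)$, $E_K\subseteq E$, with (P1) $d_K(v)\le d$ for all $v$, and (P2) every $e\in E\setminus E_K$ has an endpoint of $K$-degree at least $d(1-\epsilon)$. An edge $e\in M$ is 3-augmentable if the connected component of the symmetric difference $M\oplus M^*$ containing $e$ is an augmenting path (w.r.t. $M$, i.e., an $M$-alternating path with both endpoints unmatched by $M$) of length three. The assumption $\mu(G)\ge(2-\delta)\mu(K)$ is a standing assumption of the section. -}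

module Defs where

open import Data.Nat using (ℕ; zero; suc; _+_; _*_; _≤_; _<_; _<ᵇ_)
open import Data.Bool using (Bool; true; false; if_then_else_; _∧_; _xor_)
open import Data.Fin using (Fin; toℕ)
open import Data.List using (List; map; length)
open import Data.Nat.ListAction using (sum)
open import Data.List.Relation.Unary.All using (All)
open import Data.List.Relation.Unary.Unique.Propositional using (Unique)
open import Data.List using (allFin)
open import Data.Product using (Σ; _×_; ∃; ∃-syntax; _,_)
open import Data.Sum using (_⊎_)
open import Relation.Binary.PropositionalEquality using (_≡_; _≢_)
open import Relation.Nullary using (¬_)

record Graph (n : ℕ) : Set where
  field
    adj   : Fin n → Fin n → Bool
    sym   : ∀ u v → adj u v ≡ adj v u
    irrefl : ∀ v → adj v v ≡ false
open Graph public

count : {n : ℕ} → (Fin n → Bool) → ℕ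
count {n} p = sum (map (λ v → if p v then 1 else 0) (allFin n))

deg : {n : ℕ} → Graph n → Fin n → ℕ
deg H v = count (adj H v)

edgeCount : {n : ℕ} → Graph n → ℕ
edgeCount {n} H = sum (map (λ u → count (λ v → (toℕ u <ᵇ toℕ v) ∧ adj H u v)) (allFin n))

_⊆ᴱ_ : {n : ℕ} → Graph n → Graph n → Set
K ⊆ᴱ G = ∀ u v → adj K u v ≡ true → adj G u v ≡ true

IsMatching : {n : ℕ} → Graph n → Graph n → Set
IsMatching H M = (M ⊆ᴱ H) × (∀ v → deg M v ≤ 1)

-- a maximum matching of H (its size is μ(H))
IsMaximumMatching : {n : ℕ} → Graph n → Graph n → Set
IsMaximumMatching H M =
  IsMatching H M × (∀ M' → IsMatching H M' → edgeCount M' ≤ edgeCount M)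

-- (ε,d)-kernel, with ε = εnum / εden (εden > 0 assumed by the caller):
-- (P1) d_K(v) ≤ d ; (P2) every e ∈ E \ E_K has an endpoint with
-- d_K ≥ d(1-ε), i.e. εden·d_K + εnum·d ≥ εden·d.
IsKernel : {n : ℕ} → (εnum εden d : ℕ) → Graph n → Graph n → Set
IsKernel εnum εden d G K =
  (K ⊆ᴱ G)
  × (∀ v → deg K v ≤ d)
  × (∀ u v → adj G u v ≡ true → adj K u v ≡ false →
       (εden * d ≤ εden * deg K u + εnum * d)
       ⊎ (εden * d ≤ εden * deg K v + εnum * d))

Unmatched : {n : ℕ} → Graph n → Fin n → Set
Unmatched M v = ∀ w → adj M v w ≡ false

_⊕_ : {n : ℕ} → Graph n → Graph n → Fin n → Fin n → Bool
(M ⊕ N) u v = adj M u v xor adj N u v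

data Reach {n : ℕ} (R : Fin n → Fin n → Bool) (u : Fin n) : Fin n → Set where
  here  : Reach R u u
  there : ∀ {v w} → Reach R u v → R v w ≡ true → Reach R u w

SameEdge : {n : ℕ} → Fin n → Fin n → Fin n → Fin n → Set
SameEdge x y p q = (x ≡ p × y ≡ q) ⊎ (x ≡ q × y ≡ p)

-- The component of M ⊕ M* containing the edge {u,v} ∈ M is an augmenting
-- path a – u – v – b (w.r.t. M) of length three: a,u,v,b distinct;
-- edges au, uv, vb in M ⊕ M*, uv ∈ M, au ∉ M, vb ∉ M (alternating);
-- a, b unmatched by M; and the connected component of M ⊕ M* containing
-- u (equivalently the edge uv) has vertex set exactly {a,u,v,b} and its
-- edges are exactly au, uv, vb.
ThreeAugmentable : {n : ℕ} → (M Mstar : Graph n) → Fin n → Fin n → Set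
ThreeAugmentable {n} M Mstar u v =
  adj M u v ≡ true ×
  ∃[ a ] ∃[ b ]
    ( (a ≢ u) × (a ≢ v) × (a ≢ b) × (u ≢ v) × (u ≢ b) × (v ≢ b)
    × ((M ⊕ Mstar) a u ≡ true) × ((M ⊕ Mstar) u v ≡ true) × ((M ⊕ Mstar) v b ≡ true)
    × (adj M a u ≡ false) × (adj M v b ≡ false)
    × Unmatched M a × Unmatched M b
    × (∀ w → Reach (M ⊕ Mstar) u w → (w ≡ a) ⊎ (w ≡ u) ⊎ (w ≡ v) ⊎ (w ≡ b))
    × (∀ x y → Reach (M ⊕ Mstar) u x → (M ⊕ Mstar) x y ≡ true →
         SameEdge x y a u ⊎ SameEdge x y u v ⊎ SameEdge x y v b) )

-- a duplicate-free list of edges (u,v) of M, u < v, each 3-augmentable;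
-- "at least N edges of M are 3-augmentable" = such a list of length ≥ N.
ThreeAugList : {n : ℕ} → (M Mstar : Graph n) → List (Fin n × Fin n) → Set
ThreeAugList M Mstar es =
  Unique es × All (λ { (u , v) → (toℕ u < toℕ v) × ThreeAugmentable M Mstar u v }) es

-- Boolean test for membership in V_H, with parameters from Lemma 3.4:
-- d_K(v) ≥ d(1 - 2s - iε²), ε = 2·10⁻⁸, s = 2·10⁻⁴.
-- With D = 1/ε² = 25·10¹⁴ and 2sD = 10¹²: D·d_K(v) + d·(10¹² + i) ≥ d·D.
open import Data.Nat using (_^_; _≤ᵇ_)

epsSqInv : ℕ
epsSqInv = 25 * 10 ^ 14

inVH : {n : ℕ} → (K : Graph n) → (d i : ℕ) → Fin n → Bool
inVH K d i v = (d * epsSqInv) ≤ᵇ (epsSqInv * deg K v + d * (10 ^ 12 + i))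

unmatchedVH : {n : ℕ} → (K M : Graph n) → (d i : ℕ) → ℕ
unmatchedVH K M d i = count (λ v → inVH K d i v ∧ (deg M v ≤ᵇ 0))

module Submission where

-- Call a vertex good if its M*-partner is M-free (hasNeighbourIn Mstar (isFree M)). An M-edge uv
-- with both ends good extends to the alternating path a – u – v – b with a, b free, and since M
-- and M* have maximum degree one this path is a whole component of M ⊕ M*: the edge is
-- 3-augmentable. Double counting bounds the number A of such edges. Sorting the endpoints of
-- M*-edges by whether the opposite endpoint is free gives 2μ(G) ≤ #good + #matched = #good +
-- 2μ(K). The matched good vertices lie on M-edges, so there are at most μ(K) + A of them. An
-- M*-edge joining two free vertices is not in K, as M is maximum in K, so by (P2) one of its ends
-- has K-degree at least d(1 - ε) ≥ d(1 - 2s - iε²) and lies in V_H; hence there are at most 2 ·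
-- 7s μ(K) free good vertices. Altogether A ≥ (1 - 2δ - 14s) μ(K) ≥ (1 - 88s) μ(K).

open import Defs
open import Data.Bool using (Bool; true; false; if_then_else_; _∧_; _∨_; _xor_; not; T)
open import Data.Bool.Properties
  using (∧-comm; ∧-zeroʳ; ∧-conicalˡ; ∧-conicalʳ; ∨-identityʳ; T-≡; T-∧)
open import Data.Empty using (⊥-elim)
open import Data.Fin using (Fin; toℕ; zero; suc)
import Data.Fin.Properties as Fin
open import Data.List using (List; []; _∷_; _++_; map; length; allFin; tabulate; filter; cartesianProduct)
open import Data.List.Properties using (map-tabulate; map-++; map-∘)
open import Data.List.Relation.Unary.All as All using (All)
open import Data.List.Relation.Unary.All.Properties using (all-filter)
open import Data.List.Relation.Unary.Unique.Propositional using (Unique)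
open import Data.List.Relation.Unary.Unique.Propositional.Properties using (filter⁺; cartesianProduct⁺; allFin⁺)
open import Data.Nat using (ℕ; zero; suc; _+_; _*_; _^_; _≤_; _<_; _<ᵇ_; _≤ᵇ_; z≤n; s≤s)
open import Data.Nat.Properties
import Data.Nat.ListAction as List
open import Data.Nat.ListAction.Properties using (sum-++)
open import Data.Product using (Σ; ∃; _×_; _,_; proj₁; proj₂)
open import Data.Sum using (_⊎_; inj₁; inj₂; [_,_]′)
import Data.Sum as Sum
open import Function using (_∘_; case_of_)
open import Function.Bundles using (Equivalence; mk⇔)
open import Relation.Binary.Definitions using (tri<; tri≈; tri>)
open import Relation.Binary.PropositionalEquality hiding (sym)
import Relation.Binary.PropositionalEquality as ≡
open import Relation.Nullary using (yes; no; contradiction)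
open import Relation.Nullary.Decidable
  using (Dec; does; T?; dec-true; dec-false; does-⇔; _×-dec_; _⊎-dec_)
open import Algebra.Properties.CommutativeMonoid.Sum +-0-commutativeMonoid
  using (∑-distrib-+; ∑-comm; sum-replicate-zero; sum-cong-≗) renaming (sum to ∑)
open import Algebra.Properties.CommutativeSemigroup +-commutativeSemigroup using (xy∙z≈y∙xz)

⟦_⟧ : Bool → ℕ
⟦ b ⟧ = if b then 1 else 0

⟦∧⟧≤ : ∀ s a → ⟦ s ∧ a ⟧ ≤ ⟦ a ⟧
⟦∧⟧≤ true  a = ≤-refl
⟦∧⟧≤ false a = z≤n

⟦⟧-split : ∀ s a → ⟦ a ⟧ ≡ ⟦ s ∧ a ⟧ + ⟦ not s ∧ a ⟧
⟦⟧-split true  a = ≡.sym (+-identityʳ ⟦ a ⟧)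
⟦⟧-split false a = refl

-- Sums over Fin n

∑-mono-≤ : ∀ {n} {f g : Fin n → ℕ} → (∀ x → f x ≤ g x) → ∑ f ≤ ∑ g
∑-mono-≤ {zero}  _   = z≤n
∑-mono-≤ {suc n} f≤g = +-mono-≤ (f≤g zero) (∑-mono-≤ (f≤g ∘ suc))

term≤∑ : ∀ {n} (f : Fin n → ℕ) x → f x ≤ ∑ f
term≤∑ f zero    = m≤m+n _ _
term≤∑ f (suc x) = ≤-trans (term≤∑ (f ∘ suc) x) (m≤n+m _ _)

two-terms≤∑ : ∀ {n} (f : Fin n → ℕ) {x y} → x ≢ y → f x + f y ≤ ∑ f
two-terms≤∑ f {zero}  {zero}  x≢y = ⊥-elim (x≢y refl)
two-terms≤∑ f {zero}  {suc y} _   = +-monoʳ-≤ (f zero) (term≤∑ (f ∘ suc) y)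
two-terms≤∑ f {suc x} {zero}  _   =
  subst (_≤ ∑ f) (+-comm (f zero) (f (suc x))) (+-monoʳ-≤ (f zero) (term≤∑ (f ∘ suc) x))
two-terms≤∑ f {suc x} {suc y} x≢y =
  ≤-trans (two-terms≤∑ (f ∘ suc) (x≢y ∘ cong suc)) (m≤n+m _ _)

∑-positive : ∀ {n} (f : Fin n → ℕ) → 0 < ∑ f → ∃ λ x → 0 < f x
∑-positive {suc n} f 0<∑ with f zero in eq
... | suc _ = zero , subst (0 <_) (≡.sym eq) (s≤s z≤n)
... | zero  with ∑-positive (f ∘ suc) 0<∑
...   | x , 0<fx = suc x , 0<fx

∑-single : ∀ {n} (f : Fin n → ℕ) y → (∀ x → x ≢ y → f x ≡ 0) → ∑ f ≡ f y
∑-single {suc n} f zero    f≡0 = trans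
  (cong (f zero +_) (trans (sum-cong-≗ λ x → f≡0 (suc x) λ ()) (sum-replicate-zero n)))
  (+-identityʳ (f zero))
∑-single {suc n} f (suc y) f≡0 = trans
  (cong (_+ ∑ (f ∘ suc)) (f≡0 zero λ ()))
  (∑-single (f ∘ suc) y λ x x≢y → f≡0 (suc x) (x≢y ∘ Fin.suc-injective))

∑∑ : ∀ {n} → (Fin n → Fin n → ℕ) → ℕ
∑∑ f = ∑ λ x → ∑ λ y → f x y

∑∑-mono-≤ : ∀ {n} {f g : Fin n → Fin n → ℕ} → (∀ x y → f x y ≤ g x y) → ∑∑ f ≤ ∑∑ g
∑∑-mono-≤ f≤g = ∑-mono-≤ λ x → ∑-mono-≤ (f≤g x)

∑∑-distrib-+ : ∀ {n} (f g : Fin n → Fin n → ℕ) → ∑∑ (λ x y → f x y + g x y) ≡ ∑∑ f + ∑∑ g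
∑∑-distrib-+ f g =
  trans (sum-cong-≗ λ x → ∑-distrib-+ (f x) (g x)) (∑-distrib-+ (λ x → ∑ (f x)) (λ x → ∑ (g x)))

sum-tabulate : ∀ {n} (f : Fin n → ℕ) → List.sum (tabulate f) ≡ ∑ f
sum-tabulate {zero}  f = refl
sum-tabulate {suc n} f = cong (f zero +_) (sum-tabulate (f ∘ suc))

sum-map-allFin : ∀ {n} (f : Fin n → ℕ) → List.sum (map f (allFin n)) ≡ ∑ f
sum-map-allFin f = trans (cong List.sum (map-tabulate (λ x → x) f)) (sum-tabulate f)

count≡∑ : ∀ {n} (p : Fin n → Bool) → count p ≡ ∑ (⟦_⟧ ∘ p)
count≡∑ p = sum-map-allFin (⟦_⟧ ∘ p)

count-split : ∀ {n} (q p : Fin n → Bool) →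
  count p ≡ count (λ x → q x ∧ p x) + count (λ x → not (q x) ∧ p x)
count-split q p = begin
  count p                                                    ≡⟨ count≡∑ p ⟩
  ∑ (λ x → ⟦ p x ⟧)                                          ≡⟨ sum-cong-≗ (λ x → ⟦⟧-split (q x) (p x)) ⟩
  ∑ (λ x → ⟦ q x ∧ p x ⟧ + ⟦ not (q x) ∧ p x ⟧)
    ≡⟨ ∑-distrib-+ (λ x → ⟦ q x ∧ p x ⟧) (λ x → ⟦ not (q x) ∧ p x ⟧) ⟩
  ∑ (λ x → ⟦ q x ∧ p x ⟧) + ∑ (λ x → ⟦ not (q x) ∧ p x ⟧)
    ≡⟨ cong₂ _+_ (count≡∑ (λ x → q x ∧ p x)) (count≡∑ (λ x → not (q x) ∧ p x)) ⟨
  count (λ x → q x ∧ p x) + count (λ x → not (q x) ∧ p x)    ∎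
  where open ≡-Reasoning

-- Degrees and the handshake lemma

adj⇒≢ : ∀ {n} (H : Graph n) {u v} → adj H u v ≡ true → u ≢ v
adj⇒≢ H {u} uv refl with ≡.trans (≡.sym uv) (irrefl H u)
... | ()

deg≡∑ : ∀ {n} (H : Graph n) x → deg H x ≡ ∑ λ y → ⟦ adj H x y ⟧
deg≡∑ H x = count≡∑ (adj H x)

adj⇒1≤deg : ∀ {n} (H : Graph n) {x y} → adj H x y ≡ true → 1 ≤ deg H x
adj⇒1≤deg H {x} {y} xy = subst (1 ≤_) (≡.sym (deg≡∑ H x))
  (subst (λ b → ⟦ b ⟧ ≤ ∑ (λ w → ⟦ adj H x w ⟧)) xy (term≤∑ (λ w → ⟦ adj H x w ⟧) y))

neighbour-unique : ∀ {n} (H : Graph n) {x y w} → deg H x ≤ 1 →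
  adj H x y ≡ true → adj H x w ≡ true → w ≡ y
neighbour-unique H {x} {y} {w} deg≤1 xy xw with w Fin.≟ y
... | yes w≡y = w≡y
... | no  w≢y = ⊥-elim (1+n≰n (begin
  2                                ≡⟨ cong₂ (λ a b → ⟦ a ⟧ + ⟦ b ⟧) xw xy ⟨
  ⟦ adj H x w ⟧ + ⟦ adj H x y ⟧     ≤⟨ two-terms≤∑ (λ v → ⟦ adj H x v ⟧) w≢y ⟩
  ∑ (λ v → ⟦ adj H x v ⟧)           ≡⟨ deg≡∑ H x ⟨
  deg H x                          ≤⟨ deg≤1 ⟩
  1                                ∎))
  where open ≤-Reasoning

deg≤1-if-unique-neighbour : ∀ {n} (H : Graph n) {x} y → (∀ w → adj H x w ≡ true → w ≡ y) → deg H x ≤ 1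
deg≤1-if-unique-neighbour H {x} y only-y =
  subst (_≤ 1) (≡.sym (trans (deg≡∑ H x) deg≡⟦adj⟧)) (⟦⟧≤1 (adj H x y))
  where
  ⟦⟧≤1 : ∀ b → ⟦ b ⟧ ≤ 1
  ⟦⟧≤1 true  = ≤-refl
  ⟦⟧≤1 false = z≤n
  non-neighbour : ∀ w → w ≢ y → ⟦ adj H x w ⟧ ≡ 0
  non-neighbour w w≢y with adj H x w in xw
  ... | true  = ⊥-elim (w≢y (only-y w xw))
  ... | false = refl
  deg≡⟦adj⟧ : ∑ (λ w → ⟦ adj H x w ⟧) ≡ ⟦ adj H x y ⟧
  deg≡⟦adj⟧ = ∑-single (λ w → ⟦ adj H x w ⟧) y non-neighbour

before : ∀ {n} → Fin n → Fin n → Bool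
before u v = toℕ u <ᵇ toℕ v

before-trichotomy : ∀ {n} {u v : Fin n} → u ≢ v →
  (before u v ≡ true × before v u ≡ false) ⊎ (before u v ≡ false × before v u ≡ true)
before-trichotomy {u = u} {v} u≢v with <-cmp (toℕ u) (toℕ v)
... | tri< u<v _ v≮u = inj₁ (dec-true (toℕ u <? toℕ v) u<v , dec-false (toℕ v <? toℕ u) v≮u)
... | tri≈ _ u≡v _   = ⊥-elim (u≢v (Fin.toℕ-injective u≡v))
... | tri> u≮v _ v<u = inj₂ (dec-false (toℕ u <? toℕ v) u≮v , dec-true (toℕ v <? toℕ u) v<u)

edgeCount≡∑∑ : ∀ {n} (H : Graph n) → edgeCount H ≡ ∑∑ λ u v → ⟦ before u v ∧ adj H u v ⟧
edgeCount≡∑∑ H = trans (sum-map-allFin λ u → count (λ v → before u v ∧ adj H u v))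
  (sum-cong-≗ λ u → count≡∑ λ v → before u v ∧ adj H u v)

adj-split-by-order : ∀ {n} (H : Graph n) u v →
  ⟦ adj H u v ⟧ ≡ ⟦ before u v ∧ adj H u v ⟧ + ⟦ before v u ∧ adj H v u ⟧
adj-split-by-order H u v rewrite Graph.sym H v u with adj H u v in uv
... | false rewrite ∧-zeroʳ (before u v) | ∧-zeroʳ (before v u) = refl
... | true with before-trichotomy (adj⇒≢ H uv)
...   | inj₁ (l , l') rewrite l | l' = refl
...   | inj₂ (l , l') rewrite l | l' = refl

handshake : ∀ {n} (H : Graph n) → ∑∑ (λ u v → ⟦ adj H u v ⟧) ≡ 2 * edgeCount H
handshake H = begin
  ∑∑ (λ u v → ⟦ adj H u v ⟧)                  ≡⟨ sum-cong-≗ (λ u → sum-cong-≗ (adj-split-by-order H u)) ⟩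
  ∑∑ (λ u v → forward u v + forward v u)      ≡⟨ ∑∑-distrib-+ forward (λ u v → forward v u) ⟩
  E + ∑∑ (λ u v → forward v u)                ≡⟨ cong (E +_) (∑-comm forward) ⟨
  E + E                                       ≡⟨ cong (E +_) (+-identityʳ E) ⟨
  2 * E                                       ≡⟨ cong (2 *_) (edgeCount≡∑∑ H) ⟨
  2 * edgeCount H                             ∎
  where
  open ≡-Reasoning
  forward : _ → _ → ℕ
  forward u v = ⟦ before u v ∧ adj H u v ⟧
  E : ℕ
  E = ∑∑ forward

∑deg≡2*edgeCount : ∀ {n} (H : Graph n) → ∑ (deg H) ≡ 2 * edgeCount H
∑deg≡2*edgeCount H = trans (sum-cong-≗ (deg≡∑ H)) (handshake H)

-- The list of edges of a graph

length-filter : ∀ {A : Set} (p : A → Bool) xs →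
  length (filter (T? ∘ p) xs) ≡ List.sum (map (⟦_⟧ ∘ p) xs)
length-filter p []       = refl
length-filter p (x ∷ xs) with p x
... | true  = cong suc (length-filter p xs)
... | false = length-filter p xs

sum-cartesianProduct : ∀ {A B : Set} (f : A × B → ℕ) xs ys →
  List.sum (map f (cartesianProduct xs ys)) ≡ List.sum (map (λ x → List.sum (map (λ y → f (x , y)) ys)) xs)
sum-cartesianProduct f []       ys = refl
sum-cartesianProduct f (x ∷ xs) ys = begin
  List.sum (map f (map (x ,_) ys ++ cartesianProduct xs ys))
    ≡⟨ cong List.sum (map-++ f (map (x ,_) ys) (cartesianProduct xs ys)) ⟩
  List.sum (map f (map (x ,_) ys) ++ map f (cartesianProduct xs ys))
    ≡⟨ sum-++ (map f (map (x ,_) ys)) (map f (cartesianProduct xs ys)) ⟩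
  List.sum (map f (map (x ,_) ys)) + List.sum (map f (cartesianProduct xs ys))
    ≡⟨ cong₂ _+_ (cong List.sum (≡.sym (map-∘ ys))) (sum-cartesianProduct f xs ys) ⟩
  List.sum (map (λ y → f (x , y)) ys) + List.sum (map (λ x → List.sum (map (λ y → f (x , y)) ys)) xs) ∎
  where open ≡-Reasoning

isOrderedEdge : ∀ {n} → Graph n → Fin n × Fin n → Bool
isOrderedEdge H (u , v) = before u v ∧ adj H u v

IsOrderedEdge : ∀ {n} → Graph n → Fin n × Fin n → Set
IsOrderedEdge H (u , v) = toℕ u < toℕ v × adj H u v ≡ true

edgeList : ∀ {n} → Graph n → List (Fin n × Fin n)
edgeList {n} H = filter (T? ∘ isOrderedEdge H) (cartesianProduct (allFin n) (allFin n))

length-edgeList : ∀ {n} (H : Graph n) → length (edgeList H) ≡ edgeCount H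
length-edgeList {n} H = trans (length-filter (isOrderedEdge H) (cartesianProduct (allFin n) (allFin n)))
  (sum-cartesianProduct (⟦_⟧ ∘ isOrderedEdge H) (allFin n) (allFin n))

edgeList-unique : ∀ {n} (H : Graph n) → Unique (edgeList H)
edgeList-unique {n} H = filter⁺ (T? ∘ isOrderedEdge H) (cartesianProduct⁺ (allFin⁺ n) (allFin⁺ n))

edgeList-sound : ∀ {n} (H : Graph n) → All (IsOrderedEdge H) (edgeList H)
edgeList-sound {n} H =
  All.map sound (all-filter (T? ∘ isOrderedEdge H) (cartesianProduct (allFin n) (allFin n)))
  where
  sound : ∀ {e} → T (isOrderedEdge H e) → IsOrderedEdge H e
  sound {u , v} t with T-∧ .Equivalence.to t
  ... | u<v , uv = <ᵇ⇒< (toℕ u) (toℕ v) u<v , T-≡ .Equivalence.to uv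

-- Maximum matchings

isFree : ∀ {n} → Graph n → Fin n → Bool
isFree M x = deg M x ≤ᵇ 0

isFree⇒Unmatched : ∀ {n} (M : Graph n) {x} → isFree M x ≡ true → Unmatched M x
isFree⇒Unmatched M {x} free w with adj M x w in xw
... | false = refl
... | true  =
  ⊥-elim (1+n≰n (≤-trans (adj⇒1≤deg M xw) (≤ᵇ⇒≤ (deg M x) 0 (T-≡ .Equivalence.from free))))

¬isFree⇒1≤deg : ∀ {n} (M : Graph n) {x} → isFree M x ≡ false → 1 ≤ deg M x
¬isFree⇒1≤deg M {x} matched with deg M x
... | suc _ = s≤s z≤n

_∪_ : ∀ {n} → Graph n → Graph n → Graph n
H ∪ E = record
  { adj    = λ u v → adj H u v ∨ adj E u v
  ; sym    = λ u v → cong₂ _∨_ (Graph.sym H u v) (Graph.sym E u v)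
  ; irrefl = λ v → cong₂ _∨_ (irrefl H v) (irrefl E v)
  }

edgeCount-∪ : ∀ {n} (H E : Graph n) → (∀ u v → adj H u v ≡ true → adj E u v ≡ false) →
  edgeCount H + edgeCount E ≤ edgeCount (H ∪ E)
edgeCount-∪ H E disjoint = *-cancelˡ-≤ 2 (begin
  2 * (edgeCount H + edgeCount E)                        ≡⟨ *-distribˡ-+ 2 (edgeCount H) (edgeCount E) ⟩
  2 * edgeCount H + 2 * edgeCount E                      ≡⟨ cong₂ _+_ (handshake H) (handshake E) ⟨
  ∑∑ (λ u v → ⟦ adj H u v ⟧) + ∑∑ (λ u v → ⟦ adj E u v ⟧)
    ≡⟨ ∑∑-distrib-+ (λ u v → ⟦ adj H u v ⟧) (λ u v → ⟦ adj E u v ⟧) ⟨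
  ∑∑ (λ u v → ⟦ adj H u v ⟧ + ⟦ adj E u v ⟧)              ≤⟨ ∑∑-mono-≤ pointwise ⟩
  ∑∑ (λ u v → ⟦ adj (H ∪ E) u v ⟧)                       ≡⟨ handshake (H ∪ E) ⟩
  2 * edgeCount (H ∪ E)                                  ∎)
  where
  open ≤-Reasoning
  pointwise : ∀ u v → ⟦ adj H u v ⟧ + ⟦ adj E u v ⟧ ≤ ⟦ adj H u v ∨ adj E u v ⟧
  pointwise u v with adj H u v in uv
  ... | true  rewrite disjoint u v uv = ≤-refl
  ... | false = ≤-refl

sameEdge? : ∀ {n} (u v x y : Fin n) → Dec (SameEdge u v x y)
sameEdge? u v x y = (u Fin.≟ x ×-dec v Fin.≟ y) ⊎-dec (u Fin.≟ y ×-dec v Fin.≟ x)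

SameEdge-swap : ∀ {n} {u v x y : Fin n} → SameEdge u v x y → SameEdge v u x y
SameEdge-swap (inj₁ (u≡x , v≡y)) = inj₂ (v≡y , u≡x)
SameEdge-swap (inj₂ (u≡y , v≡x)) = inj₁ (v≡x , u≡y)

SameEdge-loop : ∀ {n} {v x y : Fin n} → SameEdge v v x y → x ≡ y
SameEdge-loop (inj₁ (v≡x , v≡y)) = trans (≡.sym v≡x) v≡y
SameEdge-loop (inj₂ (v≡y , v≡x)) = trans (≡.sym v≡x) v≡y

edge : ∀ {n} (x y : Fin n) → x ≢ y → Graph n
edge x y x≢y = record
  { adj    = λ u v → does (sameEdge? u v x y)
  ; sym    = λ u v → does-⇔ (mk⇔ SameEdge-swap SameEdge-swap) (sameEdge? u v x y) (sameEdge? v u x y)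
  ; irrefl = λ v → dec-false (sameEdge? v v x y) (x≢y ∘ SameEdge-loop)
  }

edge-adj : ∀ {n} {x y : Fin n} (x≢y : x ≢ y) u v → adj (edge x y x≢y) u v ≡ true → SameEdge u v x y
edge-adj {x = x} {y} _ u v = does⇒witness (sameEdge? u v x y)
  where
  does⇒witness : ∀ {A : Set} (a? : Dec A) → does a? ≡ true → A
  does⇒witness (yes a) _ = a

1≤edgeCount-edge : ∀ {n} {x y : Fin n} (x≢y : x ≢ y) → 1 ≤ edgeCount (edge x y x≢y)
1≤edgeCount-edge {x = x} {y} x≢y = *-cancelˡ-≤ 2 (begin
  1 + 1                                    ≤⟨ +-mono-≤ (adj⇒1≤deg E {x} {y} xy) (adj⇒1≤deg E {y} {x} yx) ⟩
  deg E x + deg E y                        ≡⟨ cong₂ _+_ (deg≡∑ E x) (deg≡∑ E y) ⟩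
  ∑ (⟦_⟧ ∘ adj E x) + ∑ (⟦_⟧ ∘ adj E y)    ≤⟨ two-terms≤∑ (λ u → ∑ (⟦_⟧ ∘ adj E u)) x≢y ⟩
  ∑∑ (λ u v → ⟦ adj E u v ⟧)               ≡⟨ handshake E ⟩
  2 * edgeCount E                          ∎)
  where
  open ≤-Reasoning
  E : Graph _
  E = edge x y x≢y
  xy : adj E x y ≡ true
  xy = dec-true (sameEdge? x y x y) (inj₁ (refl , refl))
  yx : adj E y x ≡ true
  yx = dec-true (sameEdge? y x x y) (inj₂ (refl , refl))

module _ {n} (M : Graph n) {x y : Fin n} (x≢y : x ≢ y)
         (x-free : Unmatched M x) (y-free : Unmatched M y) where

  private
    E : Graph n
    E = edge x y x≢y

  edge-disjoint : ∀ u v → adj M u v ≡ true → adj E u v ≡ false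
  edge-disjoint u v uv with adj E u v in e
  ... | false = refl
  ... | true with edge-adj x≢y u v e
  ...   | inj₁ (refl , _) = contradiction (trans (≡.sym uv) (x-free v)) λ ()
  ...   | inj₂ (refl , _) = contradiction (trans (≡.sym uv) (y-free v)) λ ()

  ∪-edge-isMatching : ∀ {K} → IsMatching K M → adj K x y ≡ true → IsMatching K (M ∪ E)
  ∪-edge-isMatching {K} (M⊆K , degM≤1) kxy = ⊆K , deg≤1
    where
    ⊆K : (M ∪ E) ⊆ᴱ K
    ⊆K u v uv with adj M u v in muv
    ... | true  = M⊆K u v muv
    ... | false with edge-adj x≢y u v uv
    ...   | inj₁ (refl , refl) = kxy
    ...   | inj₂ (refl , refl) = trans (Graph.sym K y x) kxy

    deg≤1-at-x : deg (M ∪ E) x ≤ 1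
    deg≤1-at-x = deg≤1-if-unique-neighbour (M ∪ E) y λ w xw →
      [ proj₂ , (λ (x≡y , _) → ⊥-elim (x≢y x≡y)) ]′
        (edge-adj x≢y x w (subst (λ b → b ∨ adj E x w ≡ true) (x-free w) xw))

    deg≤1-at-y : deg (M ∪ E) y ≤ 1
    deg≤1-at-y = deg≤1-if-unique-neighbour (M ∪ E) x λ w yw →
      [ (λ (y≡x , _) → ⊥-elim (x≢y (≡.sym y≡x))) , proj₂ ]′
        (edge-adj x≢y y w (subst (λ b → b ∨ adj E y w ≡ true) (y-free w) yw))

    deg≤1-elsewhere : ∀ v → v ≢ x → v ≢ y → deg (M ∪ E) v ≤ 1
    deg≤1-elsewhere v v≢x v≢y = ≤-trans
      (subst₂ _≤_ (≡.sym (deg≡∑ (M ∪ E) v)) (≡.sym (deg≡∑ M v)) (∑-mono-≤ pointwise))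
      (degM≤1 v)
      where
      pointwise : ∀ w → ⟦ adj M v w ∨ adj E v w ⟧ ≤ ⟦ adj M v w ⟧
      pointwise w with adj E v w in e
      ... | false rewrite ∨-identityʳ (adj M v w) = ≤-refl
      ... | true  = ⊥-elim ([ v≢x ∘ proj₁ , v≢y ∘ proj₁ ]′ (edge-adj x≢y v w e))

    -- Matching on the two decisions, rather than using `with`, keeps `v Fin.≟ x` from being
    -- abstracted inside the unfolded `deg (M ∪ E) v`.
    deg≤1 : ∀ v → deg (M ∪ E) v ≤ 1
    deg≤1 v = by-cases (v Fin.≟ x) (v Fin.≟ y)
      where
      by-cases : Dec (v ≡ x) → Dec (v ≡ y) → deg (M ∪ E) v ≤ 1
      by-cases (yes refl) _          = deg≤1-at-x
      by-cases (no _)     (yes refl) = deg≤1-at-y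
      by-cases (no v≢x)   (no v≢y)   = deg≤1-elsewhere v v≢x v≢y

free-vertices-nonadjacent : ∀ {n} (K M : Graph n) {x y} → IsMaximumMatching K M →
  Unmatched M x → Unmatched M y → x ≢ y → adj K x y ≡ false
free-vertices-nonadjacent K M {x} {y} (M-matching , M-maximum) x-free y-free x≢y with adj K x y in kxy
... | false = refl
... | true  = ⊥-elim (1+n≰n (begin-strict
  edgeCount M                  <⟨ m<m+n (edgeCount M) (1≤edgeCount-edge x≢y) ⟩
  edgeCount M + edgeCount E    ≤⟨ edgeCount-∪ M E (edge-disjoint M x≢y x-free y-free) ⟩
  edgeCount (M ∪ E)
    ≤⟨ M-maximum (M ∪ E) (∪-edge-isMatching M x≢y x-free y-free {K} M-matching kxy) ⟩
  edgeCount M                  ∎))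
  where
  open ≤-Reasoning
  E : Graph _
  E = edge x y x≢y

-- Counting edge ends

induced : ∀ {n} → Graph n → (Fin n → Bool) → Graph n
induced H S = record
  { adj    = λ u v → adj H u v ∧ (S u ∧ S v)
  ; sym    = λ u v → cong₂ _∧_ (Graph.sym H u v) (∧-comm (S u) (S v))
  ; irrefl = λ v → cong (_∧ (S v ∧ S v)) (irrefl H v)
  }

degIn : ∀ {n} → Graph n → (Fin n → Bool) → Fin n → ℕ
degIn H S x = ∑ λ y → ⟦ S y ∧ adj H x y ⟧

vol : ∀ {n} → Graph n → (Fin n → Bool) → ℕ
vol H S = ∑∑ λ x y → ⟦ S x ∧ adj H x y ⟧

hasNeighbourIn : ∀ {n} → Graph n → (Fin n → Bool) → Fin n → Bool
hasNeighbourIn H S x = 0 <ᵇ degIn H S x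

deg-split : ∀ {n} (H : Graph n) (S : Fin n → Bool) x → deg H x ≡ degIn H S x + degIn H (not ∘ S) x
deg-split H S x = trans (deg≡∑ H x) (trans (sum-cong-≗ λ y → ⟦⟧-split (S y) (adj H x y))
  (∑-distrib-+ (λ y → ⟦ S y ∧ adj H x y ⟧) (λ y → ⟦ not (S y) ∧ adj H x y ⟧)))

degIn≤deg : ∀ {n} (H : Graph n) (S : Fin n → Bool) x → degIn H S x ≤ deg H x
degIn≤deg H S x =
  subst (degIn H S x ≤_) (≡.sym (deg≡∑ H x)) (∑-mono-≤ λ y → ⟦∧⟧≤ (S y) (adj H x y))

degIn≡⟦hasNeighbourIn⟧ : ∀ {n} (H : Graph n) (S : Fin n → Bool) → (∀ x → deg H x ≤ 1) →
  ∀ x → degIn H S x ≡ ⟦ hasNeighbourIn H S x ⟧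
degIn≡⟦hasNeighbourIn⟧ H S deg≤1 x = ≤1⇒≡⟦0<ᵇ⟧ (≤-trans (degIn≤deg H S x) (deg≤1 x))
  where
  ≤1⇒≡⟦0<ᵇ⟧ : ∀ {k} → k ≤ 1 → k ≡ ⟦ 0 <ᵇ k ⟧
  ≤1⇒≡⟦0<ᵇ⟧ z≤n       = refl
  ≤1⇒≡⟦0<ᵇ⟧ (s≤s z≤n) = refl

hasNeighbourIn⇒∃ : ∀ {n} (H : Graph n) (S : Fin n → Bool) {x} → hasNeighbourIn H S x ≡ true →
  ∃ λ y → S y ≡ true × adj H x y ≡ true
hasNeighbourIn⇒∃ H S {x} e
  with ∑-positive (λ y → ⟦ S y ∧ adj H x y ⟧) (<ᵇ⇒< 0 (degIn H S x) (T-≡ .Equivalence.from e))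
... | y , positive = y , both-true positive
  where
  both-true : ∀ {s a} → 0 < ⟦ s ∧ a ⟧ → s ≡ true × a ≡ true
  both-true {true} {true} _ = refl , refl

∑degIn≡vol : ∀ {n} (H : Graph n) (S : Fin n → Bool) → ∑ (degIn H S) ≡ vol H S
∑degIn≡vol H S = trans (∑-comm λ x y → ⟦ S y ∧ adj H x y ⟧)
  (sum-cong-≗ λ x → sum-cong-≗ λ y → cong (λ b → ⟦ S x ∧ b ⟧) (Graph.sym H y x))

vol≤count : ∀ {n} (H : Graph n) (S : Fin n → Bool) → (∀ x → deg H x ≤ 1) → vol H S ≤ count S
vol≤count {n} H S deg≤1 = subst (vol H S ≤_) (≡.sym (count≡∑ S)) (∑-mono-≤ pointwise)
  where
  pointwise : ∀ x → ∑ (λ y → ⟦ S x ∧ adj H x y ⟧) ≤ ⟦ S x ⟧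
  pointwise x with S x
  ... | true  = subst (_≤ 1) (deg≡∑ H x) (deg≤1 x)
  ... | false = ≤-reflexive (sum-replicate-zero n)

vol≤edgeCount-induced+edgeCount : ∀ {n} (H : Graph n) (S : Fin n → Bool) →
  vol H S ≤ edgeCount (induced H S) + edgeCount H
vol≤edgeCount-induced+edgeCount H S = *-cancelˡ-≤ 2 (begin
  2 * vol H S                                           ≡⟨ cong (vol H S +_) (+-identityʳ (vol H S)) ⟩
  vol H S + vol H S                                     ≡⟨ cong (vol H S +_) (∑degIn≡vol H S) ⟨
  ∑∑ (λ x y → ⟦ S x ∧ adj H x y ⟧) + ∑∑ (λ x y → ⟦ S y ∧ adj H x y ⟧)
    ≡⟨ ∑∑-distrib-+ (λ x y → ⟦ S x ∧ adj H x y ⟧) (λ x y → ⟦ S y ∧ adj H x y ⟧) ⟨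
  ∑∑ (λ x y → ⟦ S x ∧ adj H x y ⟧ + ⟦ S y ∧ adj H x y ⟧)
    ≤⟨ ∑∑-mono-≤ (λ x y → pointwise (S x) (S y) (adj H x y)) ⟩
  ∑∑ (λ x y → ⟦ adj (induced H S) x y ⟧ + ⟦ adj H x y ⟧)
    ≡⟨ ∑∑-distrib-+ (λ x y → ⟦ adj (induced H S) x y ⟧) (λ x y → ⟦ adj H x y ⟧) ⟩
  ∑∑ (λ x y → ⟦ adj (induced H S) x y ⟧) + ∑∑ (λ x y → ⟦ adj H x y ⟧)
    ≡⟨ cong₂ _+_ (handshake (induced H S)) (handshake H) ⟩
  2 * edgeCount (induced H S) + 2 * edgeCount H
    ≡⟨ *-distribˡ-+ 2 (edgeCount (induced H S)) (edgeCount H) ⟨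
  2 * (edgeCount (induced H S) + edgeCount H)           ∎)
  where
  open ≤-Reasoning
  pointwise : ∀ s t a → ⟦ s ∧ a ⟧ + ⟦ t ∧ a ⟧ ≤ ⟦ a ∧ (s ∧ t) ⟧ + ⟦ a ⟧
  pointwise s     t     false rewrite ∧-zeroʳ s | ∧-zeroʳ t = z≤n
  pointwise true  true  true  = ≤-refl
  pointwise true  false true  = s≤s z≤n
  pointwise false true  true  = s≤s z≤n
  pointwise false false true  = z≤n

count-nonFree≤2*edgeCount : ∀ {n} (H : Graph n) → count (not ∘ isFree H) ≤ 2 * edgeCount H
count-nonFree≤2*edgeCount H = subst₂ _≤_ (≡.sym (count≡∑ (not ∘ isFree H))) (∑deg≡2*edgeCount H)
  (∑-mono-≤ λ x → nonFree≤deg (deg H x))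
  where
  nonFree≤deg : ∀ k → ⟦ not (k ≤ᵇ 0) ⟧ ≤ k
  nonFree≤deg zero    = z≤n
  nonFree≤deg (suc k) = s≤s z≤n

count-nonFree≤vol : ∀ {n} (H : Graph n) (S : Fin n → Bool) →
  count (λ x → not (isFree H x) ∧ S x) ≤ vol H S
count-nonFree≤vol H S =
  subst (_≤ vol H S) (≡.sym (count≡∑ λ x → not (isFree H x) ∧ S x)) (∑-mono-≤ pointwise)
  where
  pointwise : ∀ x → ⟦ not (isFree H x) ∧ S x ⟧ ≤ ∑ (λ y → ⟦ S x ∧ adj H x y ⟧)
  pointwise x with S x | isFree H x in free
  ... | false | b     rewrite ∧-zeroʳ (not b) = z≤n
  ... | true  | true  = z≤n
  ... | true  | false = subst (1 ≤_) (deg≡∑ H x) (¬isFree⇒1≤deg H free)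

2*edgeCount≤count-hasNeighbourIn+count-outside : ∀ {n} (H : Graph n) (S : Fin n → Bool) →
  (∀ x → deg H x ≤ 1) → 2 * edgeCount H ≤ count (hasNeighbourIn H S) + count (not ∘ S)
2*edgeCount≤count-hasNeighbourIn+count-outside H S deg≤1 = begin
  2 * edgeCount H                                  ≡⟨ ∑deg≡2*edgeCount H ⟨
  ∑ (deg H)                                        ≡⟨ sum-cong-≗ (deg-split H S) ⟩
  ∑ (λ x → degIn H S x + degIn H (not ∘ S) x)      ≡⟨ ∑-distrib-+ (degIn H S) (degIn H (not ∘ S)) ⟩
  ∑ (degIn H S) + ∑ (degIn H (not ∘ S))
    ≡⟨ cong₂ _+_ (trans (sum-cong-≗ (degIn≡⟦hasNeighbourIn⟧ H S deg≤1)) (≡.sym (count≡∑ (hasNeighbourIn H S))))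
                 (∑degIn≡vol H (not ∘ S)) ⟩
  count (hasNeighbourIn H S) + vol H (not ∘ S)     ≤⟨ +-monoʳ-≤ _ (vol≤count H (not ∘ S) deg≤1) ⟩
  count (hasNeighbourIn H S) + count (not ∘ S)     ∎
  where open ≤-Reasoning

count-hasNeighbourIn≤2*count-cover : ∀ {n} (H : Graph n) (S C : Fin n → Bool) → (∀ x → deg H x ≤ 1) →
  (∀ x y → S x ≡ true → S y ≡ true → adj H x y ≡ true → C x ≡ true ⊎ C y ≡ true) →
  count (λ x → S x ∧ hasNeighbourIn H S x) ≤ 2 * count (λ x → C x ∧ S x)
count-hasNeighbourIn≤2*count-cover {n} H S C deg≤1 cover = begin
  count (λ x → S x ∧ hasNeighbourIn H S x)          ≡⟨ count≡∑ (λ x → S x ∧ hasNeighbourIn H S x) ⟩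
  ∑ (λ x → ⟦ S x ∧ hasNeighbourIn H S x ⟧)          ≤⟨ ∑-mono-≤ edge-inside ⟩
  ∑∑ (λ x y → ⟦ S x ∧ (S y ∧ adj H x y) ⟧)          ≤⟨ ∑∑-mono-≤ covered ⟩
  ∑∑ (λ x y → ⟦ c x ∧ adj H x y ⟧ + ⟦ c y ∧ adj H x y ⟧)
    ≡⟨ ∑∑-distrib-+ (λ x y → ⟦ c x ∧ adj H x y ⟧) (λ x y → ⟦ c y ∧ adj H x y ⟧) ⟩
  vol H c + ∑ (degIn H c)                           ≡⟨ cong (vol H c +_) (∑degIn≡vol H c) ⟩
  vol H c + vol H c                                 ≤⟨ +-mono-≤ (vol≤count H c deg≤1) (vol≤count H c deg≤1) ⟩
  count c + count c                                 ≡⟨ cong (count c +_) (+-identityʳ (count c)) ⟨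
  2 * count c                                       ∎
  where
  open ≤-Reasoning
  c : Fin n → Bool
  c x = C x ∧ S x
  edge-inside : ∀ x → ⟦ S x ∧ hasNeighbourIn H S x ⟧ ≤ ∑ (λ y → ⟦ S x ∧ (S y ∧ adj H x y) ⟧)
  edge-inside x with S x
  ... | true  = ≤-reflexive (≡.sym (degIn≡⟦hasNeighbourIn⟧ H S deg≤1 x))
  ... | false = z≤n
  covered : ∀ x y → ⟦ S x ∧ (S y ∧ adj H x y) ⟧ ≤ ⟦ c x ∧ adj H x y ⟧ + ⟦ c y ∧ adj H x y ⟧
  covered x y with S x in sx | S y in sy | adj H x y in xy
  ... | false | _     | _     = z≤n
  ... | true  | false | _     = z≤n
  ... | true  | true  | false = z≤n
  ... | true  | true  | true  with cover x y sx sy xy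
  ...   | inj₁ cx rewrite cx = s≤s z≤n
  ...   | inj₂ cy rewrite cy = m≤n+m 1 _

2*edgeCount≤2*count-cover+edgeCount-induced+3*edgeCount :
  ∀ {n} (M N : Graph n) (C : Fin n → Bool) → (∀ x → deg M x ≤ 1) → (∀ x → deg N x ≤ 1) →
  (∀ x y → isFree M x ≡ true → isFree M y ≡ true → adj N x y ≡ true → C x ≡ true ⊎ C y ≡ true) →
  2 * edgeCount N ≤ 2 * count (λ x → C x ∧ isFree M x)
                    + edgeCount (induced M (hasNeighbourIn N (isFree M))) + 3 * edgeCount M
2*edgeCount≤2*count-cover+edgeCount-induced+3*edgeCount {n} M N C degM≤1 degN≤1 cover = begin
  2 * edgeCount N                           ≤⟨ 2*edgeCount≤count-hasNeighbourIn+count-outside N F degN≤1 ⟩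
  count h + count (not ∘ F)                 ≡⟨ cong (_+ count (not ∘ F)) (count-split F h) ⟩
  count (λ x → F x ∧ h x) + count (λ x → not (F x) ∧ h x) + count (not ∘ F)
    ≤⟨ +-mono-≤ (+-mono-≤ (count-hasNeighbourIn≤2*count-cover N F C degN≤1 cover)
                          (≤-trans (count-nonFree≤vol M h) (vol≤edgeCount-induced+edgeCount M h)))
                (count-nonFree≤2*edgeCount M) ⟩
  2 * U + (edgeCount (induced M h) + edgeCount M) + 2 * edgeCount M
    ≡⟨ cong (_+ 2 * edgeCount M) (+-assoc (2 * U) (edgeCount (induced M h)) (edgeCount M)) ⟨
  2 * U + edgeCount (induced M h) + edgeCount M + 2 * edgeCount M
    ≡⟨ +-assoc (2 * U + edgeCount (induced M h)) (edgeCount M) (2 * edgeCount M) ⟩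
  2 * U + edgeCount (induced M h) + 3 * edgeCount M ∎
  where
  open ≤-Reasoning
  F h : Fin n → Bool
  F = isFree M
  h = hasNeighbourIn N F
  U : ℕ
  U = count (λ x → C x ∧ F x)

-- Augmenting paths of length three

Reach-closed : ∀ {n} {R : Fin n → Fin n → Bool} (P : Fin n → Set) →
  (∀ {z w} → P z → R z w ≡ true → P w) → ∀ {u w} → P u → Reach R u w → P w
Reach-closed P step Pu here        = Pu
Reach-closed P step Pu (there r e) = step (Reach-closed P step Pu r) e

⊕-cases : ∀ {n} (M N : Graph n) {x w} → (M ⊕ N) x w ≡ true → adj M x w ≡ true ⊎ adj N x w ≡ true
⊕-cases M N {x} {w} e with adj M x w
... | true  = inj₁ refl
... | false = inj₂ e

threeAugmentable : ∀ {n} (M N : Graph n) → (∀ x → deg M x ≤ 1) → (∀ x → deg N x ≤ 1) →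
  ∀ {a u v b} → adj M u v ≡ true → adj N u a ≡ true → adj N v b ≡ true →
  Unmatched M a → Unmatched M b → ThreeAugmentable M N u v
threeAugmentable {n} M N degM≤1 degN≤1 {a} {u} {v} {b} uv ua vb a-free b-free =
  uv , a , b , a≢u , a≢v , a≢b , u≢v , u≢b , v≢b , xor-au , xor-uv , xor-vb , a-free u , Mvb ,
  a-free , b-free ,
  (λ w r → Reach-closed OnPath step u-on-path r) ,
  (λ x y r e → edge-on-path (Reach-closed OnPath step u-on-path r) e)
  where
  vu : adj M v u ≡ true
  vu = trans (Graph.sym M v u) uv
  au : adj N a u ≡ true
  au = trans (Graph.sym N a u) ua
  bv : adj N b v ≡ true
  bv = trans (Graph.sym N b v) vb
  u≢v : u ≢ v
  u≢v = adj⇒≢ M uv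
  a≢u : a ≢ u
  a≢u = adj⇒≢ N au
  a≢v : a ≢ v
  a≢v a≡v = case trans (≡.sym (a-free u)) (trans (cong (λ z → adj M z u) a≡v) vu) of λ ()
  u≢b : u ≢ b
  u≢b u≡b = case trans (≡.sym (b-free v)) (trans (cong (λ z → adj M z v) (≡.sym u≡b)) uv) of λ ()
  v≢b : v ≢ b
  v≢b = adj⇒≢ N vb
  a≢b : a ≢ b
  a≢b refl = u≢v (≡.sym (neighbour-unique N (degN≤1 a) au bv))
  Nuv : adj N u v ≡ false
  Nuv with adj N u v in e
  ... | false = refl
  ... | true  = ⊥-elim (a≢v (≡.sym (neighbour-unique N (degN≤1 u) ua e)))
  Mvb : adj M v b ≡ false
  Mvb = trans (Graph.sym M v b) (b-free v)
  xor-au : (M ⊕ N) a u ≡ true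
  xor-au = cong₂ _xor_ (a-free u) au
  xor-uv : (M ⊕ N) u v ≡ true
  xor-uv = cong₂ _xor_ uv Nuv
  xor-vb : (M ⊕ N) v b ≡ true
  xor-vb = cong₂ _xor_ Mvb vb

  next-a : ∀ {w} → (M ⊕ N) a w ≡ true → w ≡ u
  next-a {w} e = [ (λ aw → case trans (≡.sym aw) (a-free w) of λ ()) , neighbour-unique N (degN≤1 a) au ]′
    (⊕-cases M N e)
  next-u : ∀ {w} → (M ⊕ N) u w ≡ true → w ≡ v ⊎ w ≡ a
  next-u e = Sum.map (neighbour-unique M (degM≤1 u) uv) (neighbour-unique N (degN≤1 u) ua) (⊕-cases M N e)
  next-v : ∀ {w} → (M ⊕ N) v w ≡ true → w ≡ u ⊎ w ≡ b
  next-v e = Sum.map (neighbour-unique M (degM≤1 v) vu) (neighbour-unique N (degN≤1 v) vb) (⊕-cases M N e)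
  next-b : ∀ {w} → (M ⊕ N) b w ≡ true → w ≡ v
  next-b {w} e = [ (λ bw → case trans (≡.sym bw) (b-free w) of λ ()) , neighbour-unique N (degN≤1 b) bv ]′
    (⊕-cases M N e)

  OnPath : Fin n → Set
  OnPath w = (w ≡ a) ⊎ (w ≡ u) ⊎ (w ≡ v) ⊎ (w ≡ b)

  u-on-path : OnPath u
  u-on-path = inj₂ (inj₁ refl)

  step : ∀ {z w} → OnPath z → (M ⊕ N) z w ≡ true → OnPath w
  step (inj₁ refl)               e = inj₂ (inj₁ (next-a e))
  step (inj₂ (inj₁ refl))        e = [ inj₂ ∘ inj₂ ∘ inj₁ , inj₁ ]′ (next-u e)
  step (inj₂ (inj₂ (inj₁ refl))) e = [ inj₂ ∘ inj₁ , inj₂ ∘ inj₂ ∘ inj₂ ]′ (next-v e)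
  step (inj₂ (inj₂ (inj₂ refl))) e = inj₂ (inj₂ (inj₁ (next-b e)))

  edge-on-path : ∀ {x y} → OnPath x → (M ⊕ N) x y ≡ true →
    SameEdge x y a u ⊎ SameEdge x y u v ⊎ SameEdge x y v b
  edge-on-path (inj₁ refl)               e = inj₁ (inj₁ (refl , next-a e))
  edge-on-path (inj₂ (inj₁ refl))        e =
    [ (λ y≡v → inj₂ (inj₁ (inj₁ (refl , y≡v)))) , (λ y≡a → inj₁ (inj₂ (refl , y≡a))) ]′ (next-u e)
  edge-on-path (inj₂ (inj₂ (inj₁ refl))) e =
    [ (λ y≡u → inj₂ (inj₁ (inj₂ (refl , y≡u)))) , (λ y≡b → inj₂ (inj₂ (inj₁ (refl , y≡b)))) ]′ (next-v e)
  edge-on-path (inj₂ (inj₂ (inj₂ refl))) e = inj₂ (inj₂ (inj₂ (refl , next-b e)))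

augmentable-edge⇒threeAugmentable : ∀ {n} (M N : Graph n) → (∀ x → deg M x ≤ 1) → (∀ x → deg N x ≤ 1) →
  ∀ {u v} → adj (induced M (hasNeighbourIn N (isFree M))) u v ≡ true → ThreeAugmentable M N u v
augmentable-edge⇒threeAugmentable {n} M N degM≤1 degN≤1 {u} {v} e =
  let (a , a-free , ua) = hasNeighbourIn⇒∃ N F (∧-conicalˡ (h u) (h v) hu∧hv)
      (b , b-free , vb) = hasNeighbourIn⇒∃ N F (∧-conicalʳ (h u) (h v) hu∧hv)
  in threeAugmentable M N degM≤1 degN≤1 (∧-conicalˡ (adj M u v) (h u ∧ h v) e) ua vb
       (isFree⇒Unmatched M a-free) (isFree⇒Unmatched M b-free)
  where
  F h : Fin n → Bool
  F = isFree M
  h = hasNeighbourIn N F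
  hu∧hv : h u ∧ h v ≡ true
  hu∧hv = ∧-conicalʳ (adj M u v) (h u ∧ h v) e

-- The kernel condition and the constants

square-threshold : ∀ c d k t → c ≤ t → c * d ≤ c * k + 1 * d → d * (c * c) ≤ c * c * k + d * t
square-threshold c d k t c≤t bound = begin
  d * (c * c)                ≡⟨ *-comm d (c * c) ⟩
  c * c * d                  ≡⟨ *-assoc c c d ⟩
  c * (c * d)                ≤⟨ *-monoʳ-≤ c bound ⟩
  c * (c * k + 1 * d)        ≡⟨ *-distribˡ-+ c (c * k) (1 * d) ⟩
  c * (c * k) + c * (1 * d)
    ≡⟨ cong₂ _+_ (*-assoc c c k) (trans (*-comm d c) (cong (c *_) (≡.sym (*-identityˡ d)))) ⟨
  c * c * k + d * c          ≤⟨ +-monoʳ-≤ (c * c * k) (*-monoʳ-≤ d c≤t) ⟩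
  c * c * k + d * t          ∎
  where open ≤-Reasoning

-- (P2) only gives d_K(v) ≥ d(1 - ε), but ε = 1/(5·10⁷) < 2s, so this already reaches the V_H
-- threshold d(1 - 2s - iε²) for every i.  The implicit arguments are supplied because inferring
-- them makes Agda unfold the numerals.
kernel-bound⇒inVH : ∀ {n} (K : Graph n) d i v →
  5 * 10 ^ 7 * d ≤ 5 * 10 ^ 7 * deg K v + 1 * d → inVH K d i v ≡ true
kernel-bound⇒inVH K d i v bound = T-≡ {inVH K d i v} .Equivalence.to
  (≤⇒≤ᵇ {d * epsSqInv} {epsSqInv * deg K v + d * (10 ^ 12 + i)}
    (square-threshold (5 * 10 ^ 7) d (deg K v) (10 ^ 12 + i) 1/ε≤2s/ε²+i bound))
  where
  1/ε≤2s/ε²+i : 5 * 10 ^ 7 ≤ 10 ^ 12 + i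
  1/ε≤2s/ε²+i = ≤-trans {5 * 10 ^ 7} {10 ^ 12} (≤ᵇ⇒≤ (5 * 10 ^ 7) (10 ^ 12) _) (m≤m+n (10 ^ 12) i)

free-edges-meet-VH : ∀ {n} (G K M N : Graph n) d i → IsKernel 1 (5 * 10 ^ 7) d G K →
  IsMaximumMatching K M → N ⊆ᴱ G →
  ∀ x y → isFree M x ≡ true → isFree M y ≡ true → adj N x y ≡ true →
  inVH K d i x ≡ true ⊎ inVH K d i y ≡ true
free-edges-meet-VH G K M N d i (_ , _ , P2) M-maximum N⊆G x y x-free y-free xy =
  Sum.map (kernel-bound⇒inVH K d i x) (kernel-bound⇒inVH K d i y)
    (P2 x y (N⊆G x y xy) (free-vertices-nonadjacent K M M-maximum
      (isFree⇒Unmatched M {x} x-free) (isFree⇒Unmatched M {y} y-free) (adj⇒≢ N xy)))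

5000*μK≤5000*A+88*μK : ∀ μK μG U A → 2 * μG ≤ 2 * U + A + 3 * μK → 5000 * U ≤ 7 * μK →
  1000000 * μK ≤ 500000 * μG + μK → 5000 * μK ≤ 5000 * A + 88 * μK
5000*μK≤5000*A+88*μK m μG U A matching-bound few-unmatched large-μG = *-cancelˡ-≤ 50 (begin
  50 * (5000 * m)                  ≡⟨ *-assoc 50 5000 m ⟨
  250000 * m                       ≡⟨ *-distribʳ-+ m 249299 701 ⟩
  249299 * m + 701 * m             ≤⟨ +-mono-≤ 249299m≤250000A (*-monoˡ-≤ m (≤ᵇ⇒≤ 701 4400 _)) ⟩
  250000 * A + 4400 * m            ≡⟨ cong₂ _+_ (*-assoc 50 5000 A) (*-assoc 50 88 m) ⟩
  50 * (5000 * A) + 50 * (88 * m)  ≡⟨ *-distribˡ-+ 50 (5000 * A) (88 * m) ⟨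
  50 * (5000 * A + 88 * m)         ∎)
  where
  open ≤-Reasoning
  500000μG≤ : 500000 * μG ≤ 500000 * U + 250000 * A + 750000 * m
  500000μG≤ = begin
    500000 * μG                                  ≡⟨ *-assoc 250000 2 μG ⟩
    250000 * (2 * μG)                            ≤⟨ *-monoʳ-≤ 250000 matching-bound ⟩
    250000 * (2 * U + A + 3 * m)                 ≡⟨ *-distribˡ-+ 250000 (2 * U + A) (3 * m) ⟩
    250000 * (2 * U + A) + 250000 * (3 * m)
      ≡⟨ cong₂ _+_ (*-distribˡ-+ 250000 (2 * U) A) (≡.sym (*-assoc 250000 3 m)) ⟩
    250000 * (2 * U) + 250000 * A + 750000 * m   ≡⟨ cong (λ z → z + 250000 * A + 750000 * m) (*-assoc 250000 2 U) ⟨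
    500000 * U + 250000 * A + 750000 * m         ∎
  collect : 100 * (7 * m) + 750000 * m + m ≡ 750701 * m
  collect = begin-equality
    100 * (7 * m) + 750000 * m + m   ≡⟨ cong (λ z → z + 750000 * m + m) (*-assoc 100 7 m) ⟨
    700 * m + 750000 * m + m         ≡⟨ cong (_+ m) (*-distribʳ-+ m 700 750000) ⟨
    750700 * m + m                   ≡⟨ +-comm (750700 * m) m ⟩
    750701 * m                       ∎
  249299m≤250000A : 249299 * m ≤ 250000 * A
  249299m≤250000A = +-cancelʳ-≤ (750701 * m) (249299 * m) (250000 * A) (begin
    249299 * m + 750701 * m                        ≡⟨ *-distribʳ-+ m 249299 750701 ⟨
    1000000 * m                                    ≤⟨ large-μG ⟩
    500000 * μG + m                                ≤⟨ +-monoˡ-≤ m 500000μG≤ ⟩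
    500000 * U + 250000 * A + 750000 * m + m
      ≤⟨ +-monoˡ-≤ m (+-monoˡ-≤ (750000 * m) (+-monoˡ-≤ (250000 * A)
           (≤-trans (≤-reflexive (*-assoc 100 5000 U)) (*-monoʳ-≤ 100 few-unmatched)))) ⟩
    100 * (7 * m) + 250000 * A + 750000 * m + m
      ≡⟨ cong (_+ m) (xy∙z≈y∙xz (100 * (7 * m)) (250000 * A) (750000 * m)) ⟩
    250000 * A + (100 * (7 * m) + 750000 * m) + m  ≡⟨ +-assoc (250000 * A) (100 * (7 * m) + 750000 * m) m ⟩
    250000 * A + (100 * (7 * m) + 750000 * m + m)  ≡⟨ cong (250000 * A +_) collect ⟩
    250000 * A + 750701 * m                        ∎)

lemma3p4 : (n : ℕ) (G K : Graph n) (d i : ℕ)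
    → 5 * 10 ^ 7 ≤ d
    → IsKernel 1 (5 * 10 ^ 7) d G K
    → 1 ≤ i → i ≤ 5 * 10 ^ 7
    → (M Mstar : Graph n)
    → IsMaximumMatching K M
    → IsMaximumMatching G Mstar
    → 1000000 * edgeCount M ≤ 500000 * edgeCount Mstar + edgeCount M
    → 5000 * unmatchedVH K M d i ≤ 7 * edgeCount M
    → Σ (List (Fin n × Fin n)) λ es →
    ThreeAugList M Mstar es × (5000 * edgeCount M ≤ 5000 * length es + 88 * edgeCount M)
lemma3p4 n G K d i _ kernel _ _ M Mstar M-maximum Mstar-maximum large-μG few-unmatched =
  edgeList A , (edgeList-unique A , All.map (λ { {u , v} → threeAugmentable-edge }) (edgeList-sound A)) ,
  subst (λ a → 5000 * edgeCount M ≤ 5000 * a + 88 * edgeCount M) (≡.sym (length-edgeList A))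
    (5000*μK≤5000*A+88*μK (edgeCount M) (edgeCount Mstar) (unmatchedVH K M d i) (edgeCount A)
      (2*edgeCount≤2*count-cover+edgeCount-induced+3*edgeCount M Mstar (inVH K d i) degM≤1 degMstar≤1
        (free-edges-meet-VH G K M Mstar d i kernel M-maximum (proj₁ (proj₁ Mstar-maximum))))
      few-unmatched large-μG)
  where
  A : Graph n
  A = induced M (hasNeighbourIn Mstar (isFree M))
  degM≤1 : ∀ x → deg M x ≤ 1
  degM≤1 = proj₂ (proj₁ M-maximum)
  degMstar≤1 : ∀ x → deg Mstar x ≤ 1
  degMstar≤1 = proj₂ (proj₁ Mstar-maximum)
  threeAugmentable-edge : ∀ {u v} → IsOrderedEdge A (u , v) → toℕ u < toℕ v × ThreeAugmentable M Mstar u v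
  threeAugmentable-edge (u<v , uv) = u<v , augmentable-edge⇒threeAugmentable M Mstar degM≤1 degMstar≤1 uv
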